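{- Let $\{G_k\}_{k\ge1}$ be a worst-case family, $k\ge1$ and $w\in\{L,R\}^{\le k}$. Then (1) $f_L(G_w)=(G'_{wL},1)$; (2) $f_R(G_w,W^0(G'_{wL}),0)=G'_{wR}$; (3) if $w\neq\varepsilon$, $f_L(G'_w)=(G_w,0)$.
   Context: Parity games $G=(V_0,V_1,E,\mathrm{pr})$: finite positions $V=V_0\sqcup V_1$ owned by players $0,1$, left-total moves $E$, priorities $\mathrm{pr}:V\to\mathbb N$; player $0$ wins a play iff the maximal priority seen infinitely often is even; $W^\wp(G)$ is the winning region of player $\wp$. For $X\subseteq V$, the $\wp$-attractor $\mathrm{Attr}^\wp_G(X)$ is the least $A\supseteq X$ containing every $\wp$-position with some successor in $A$ and every $(1-\wp)$-position with all successors in $A$; $G\setminus A$ is the game restricted to $V\setminus A$. The subgame-computation functions of the Recursive algorithm: $f_L(G)=(G\setminus\mathrm{Attr}^\wp_G(\mathrm{pr}^{ -1}(p)),\wp)$, where $p$ is the maximal priority in $G$ and $\wp=p\bmod 2$; and $f_R(G,W,\wp')=G\setminus\mathrm{Attr}^{\wp'}_G(W)$. Core game $G^C_k$ ($k\ge1$): positions $\alpha_i,\beta_i,\gamma_i$ for $i\in[0,2k]$; $\alpha_i$ owned by player $i\bmod2$ with priority $2k+i+1$; $\beta_i$ owned by player $i\bmod 2$ with priority $i$; $\gamma_i$ owned by player $(i+1)\bmod2$ with priority $i$. Moves: $\alpha_i\to\beta_i$ only; $\beta_i\to\gamma_i$ and, if $i>0$, $\beta_i\to\alpha_{i-1}$;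 $\gamma_i\to\gamma_i$, $\gamma_i\to\beta_i$ and, if $i<2k$, $\gamma_i\to\alpha_{i+1}$. A game $G$ is a core extension of $G^C_k$ if, with $P$ the set of positions of $G$ not in $G^C_k$: (i) the restriction of $G$ to the positions of $G^C_k$ equals $G^C_k$; (ii) $\mathrm{pr}(v)<\mathrm{pr}(\alpha_0)$ for all $v\in P$; (iii) no $\alpha_i$ or $\beta_i$ has a move to or from a position of $P$; (iv) for every $i\in[0,2k]$ and $v\in P$ with $(\gamma_i,v)\in E$: $v$ is owned by player $i\bmod2$, $(v,\gamma_i)\in E$, and $\mathrm{pr}(v)\le i$. A worst-case family is a family $\{G_k\}_{k\ge1}$ with each $G_k$ a core extension of $G^C_k$. Induced subgame tree for fixed $k$: games $G_w$ ($w\in\{L,R\}^{\le k}$) and $G'_w$ ($w\in\{L,R\}^{\le k+1}$, $w\ne\varepsilon$), with $G_\varepsilon=G_k$ and, for $z_w=2(k-|w|)$: $G'_{wL}=G_w\setminus\mathrm{Attr}^1_{G_w}(\{\alpha_{z_w}\})$; $G'_{wR}=G_w\setminus\mathrm{Attr}^0_{G_w}(W^0(G'_{wL}))$; and, for $w\ne\varepsilon$, $G_w=G'_w\setminus \mathrm{Attr}^0_{G'_w}(\{\alpha_{z_w+1}\})$. -}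

module Defs where

open import Data.Nat using (ℕ; zero; suc; _+_; _*_; _≤_; _<_)
open import Data.Nat.DivMod using (_mod_)
open import Data.Fin using (Fin; toℕ)
open import Data.Bool using (Bool; true; false)
open import Data.List using (List; map; upTo)
open import Data.Product using (Σ; _×_; _,_; proj₁; proj₂)
open import Relation.Binary.PropositionalEquality using (_≡_; _≢_)
open import Data.Unit using (⊤)
open import Relation.Nullary using (¬_)

Player : Set
Player = Fin 2

record Game : Set₁ where
  field
    n     : ℕ
    owner : Fin n → Player
    pr    : Fin n → ℕ
    E     : Fin n → Fin n → Bool
    total : ∀ v → Σ (Fin n) λ u → E v u ≡ true

-- Subgames of a game = sets of positions (the restricted game inherits
-- owners, priorities and moves).

module GameTheory (G : Game) where
  open Game G public

  Pos : Set
  Pos = Fin n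

  Sub : Set₁
  Sub = Pos → Set

  Full : Sub
  Full _ = ⊤

  _∖_ : Sub → Sub → Sub
  (S ∖ A) v = S v × ¬ A v

  _≐_ : Sub → Sub → Set
  A ≐ B = ∀ v → (A v → B v) × (B v → A v)

  Move : Pos → Pos → Set
  Move v u = E v u ≡ true

  data Attr (℘ : Player) (S : Sub) (X : Sub) : Pos → Set where
    base : ∀ {v} → S v → X v → Attr ℘ S X v
    own  : ∀ {v} u → S v → owner v ≡ ℘ → Move v u → S u →
           Attr ℘ S X u → Attr ℘ S X v
    opp  : ∀ {v} → S v → owner v ≢ ℘ →
           (∀ u → Move v u → S u → Attr ℘ S X u) → Attr ℘ S X v

  -- Strategies for player ℘ (history-dependent): given the history of
  -- earlier positions and the current position, choose the next one.
  Strategy : Set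
  Strategy = List Pos → Pos → Pos

  Legal : Player → Sub → Strategy → Set
  Legal ℘ S σ = ∀ h v → S v → owner v ≡ ℘ →
                Σ Pos (λ u → Move v u × S u) →
                Move v (σ h v) × S (σ h v)

  Consistent : Player → Sub → Strategy → Pos → (ℕ → Pos) → Set
  Consistent ℘ S σ v π =
    (π 0 ≡ v) ×
    (∀ m → S (π m)) ×
    (∀ m → Move (π m) (π (suc m))) ×
    (∀ m → owner (π m) ≡ ℘ → π (suc m) ≡ σ (map π (upTo m)) (π m))

  Wins0 : (ℕ → Pos) → Set
  Wins0 π = Σ ℕ λ p →
    (p mod 2 ≡ Data.Fin.zero) ×
    (∀ N → Σ ℕ λ m → N ≤ m × pr (π m) ≡ p) ×
    Σ ℕ (λ N → ∀ m → N ≤ m → pr (π m) ≤ p)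

  W0 : Sub → Sub
  W0 S v = S v × Σ Strategy λ σ → Legal Data.Fin.zero S σ ×
           (∀ π → Consistent Data.Fin.zero S σ v π → Wins0 π)

  IsMaxPr : Sub → ℕ → Set
  IsMaxPr S p = Σ Pos (λ v → S v × pr v ≡ p) × (∀ v → S v → pr v ≤ p)

  FL : Sub → Sub → Player → Set
  FL S H ℘ = Σ ℕ λ p → IsMaxPr S p × (℘ ≡ p mod 2) ×
             (H ≐ (S ∖ Attr ℘ S (λ v → S v × pr v ≡ p)))

  fR : Sub → Sub → Player → Sub
  fR S W ℘' = S ∖ Attr ℘' S W

data Kind : Set where
  kα kβ kγ : Kind

CorePos : ℕ → Set
CorePos k = Kind × Fin (suc (2 * k))

coreOwner : ∀ {k} → CorePos k → Player
coreOwner (kα , i) = toℕ i mod 2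
coreOwner (kβ , i) = toℕ i mod 2
coreOwner (kγ , i) = suc (toℕ i) mod 2

corePr : ∀ k → CorePos k → ℕ
corePr k (kα , i) = 2 * k + toℕ i + 1
corePr k (kβ , i) = toℕ i
corePr k (kγ , i) = toℕ i

data CoreE {k : ℕ} : CorePos k → CorePos k → Set where
  αβ : ∀ i → CoreE (kα , i) (kβ , i)
  βγ : ∀ i → CoreE (kβ , i) (kγ , i)
  βα : ∀ i j → toℕ i ≡ suc (toℕ j) → CoreE (kβ , i) (kα , j)
  γγ : ∀ i → CoreE (kγ , i) (kγ , i)
  γβ : ∀ i → CoreE (kγ , i) (kβ , i)
  γα : ∀ i j → toℕ j ≡ suc (toℕ i) → CoreE (kγ , i) (kα , j)

-- Core extensions of G^C_k: a game G with an injective embedding ι of the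
-- core positions; P = positions outside the image of ι.

record CoreExt (k : ℕ) : Set₁ where
  field
    G : Game
  open Game G
  field
    ι      : CorePos k → Fin n
    ι-inj  : ∀ c d → ι c ≡ ι d → c ≡ d
  InP : Fin n → Set
  InP v = ∀ c → ι c ≢ v
  field
    ι-owner : ∀ c → owner (ι c) ≡ coreOwner {k} c
    ι-pr    : ∀ c → pr (ι c) ≡ corePr k c
    ι-E     : ∀ c d → (E (ι c) (ι d) ≡ true → CoreE {k} c d) ×
                      (CoreE {k} c d → E (ι c) (ι d) ≡ true)
    -- (ii) priorities of P are below pr(α_0) = 2k+1
    P-pr    : ∀ v → InP v → pr v < 2 * k + 1
    P-α     : ∀ i v → InP v → (E (ι (kα , i)) v ≡ false) × (E v (ι (kα , i)) ≡ false)
    P-β     : ∀ i v → InP v → (E (ι (kβ , i)) v ≡ false) × (E v (ι (kβ , i)) ≡ false)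
    -- (iv) moves from γ_i into P
    P-γ     : ∀ i v → InP v → E (ι (kγ , i)) v ≡ true →
              (owner v ≡ toℕ i mod 2) × (E v (ι (kγ , i)) ≡ true) × (pr v ≤ toℕ i)

-- Words over {L,R}, extended on the right (w ▷ d  is  wd)

data Dir : Set where
  L R : Dir

data Word : Set where
  ε   : Word
  _▷_ : Word → Dir → Word

len : Word → ℕ
len ε = 0
len (w ▷ _) = suc (len w)

module Tree {k : ℕ} (X : CoreExt k) where
  open CoreExt X using (G; ι)
  open GameTheory G public

  z : Word → ℕ
  z w = 2 * (k Data.Nat.∸ len w)

  -- the singleton {α_m}  (empty if m > 2k)
  Alpha : ℕ → Sub
  Alpha m v = Σ (Fin (suc (2 * k))) λ j → (toℕ j ≡ m) × (ι (kα , j) ≡ v)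

  mutual
    Gs : Word → Sub
    Gs ε = Full
    Gs (w ▷ d) = G's (w ▷ d) ∖ Attr Data.Fin.zero (G's (w ▷ d)) (Alpha (suc (z (w ▷ d))))

    -- G'_w  (G'_ε is not used; set to the whole game)
    G's : Word → Sub
    G's ε = Full
    G's (w ▷ L) = G'L w
    G's (w ▷ R) = Gs w ∖ Attr Data.Fin.zero (Gs w) (W0 (G'L w))

    G'L : Word → Sub
    G'L w = Gs w ∖ Attr (Data.Fin.suc Data.Fin.zero) (Gs w) (Alpha (z w))

-- G_w contains all core positions of index at
-- most z_w and no α_j with j > z_w; G'_{wd} contains α_i and β_i for i ≤ z_{wd} + 1, γ_i for
-- i ≤ z_{wd}, and no α_j with j > z_{wd} + 1. The α's carry the largest priorities, increasing
-- with the index, so the maximal priority of G_w is the odd one of α_{z_w} and that of G'_{wd} the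
-- even one of α_{z_{wd}+1}: this gives (1) and (3), while (2) holds by definition.
--
-- The shapes are carried down the tree by exhibiting traps which the attractors cannot enter; a
-- P-position entered from a γ may join such a trap since, by condition (iv), its owner can move
-- back to that γ. For f_R two facts about G'_{wL} are needed. Player 0 wins none of its surviving
-- core positions: player 1 cycles α_i → β_i → γ_i → α_{i+1} and returns from P-positions to the
-- γ they were entered from, so some odd priority is eventually the largest one seen infinitely
-- often. And player 0 wins γ_{z_w} by always returning to it, so α_{z_w} is 0-attracted to
-- W^0(G'_{wL}) and absent from G'_{wR}.

module Submission where

open import Defs
open import Data.Nat using (ℕ; zero; suc; _+_; _*_; _∸_; _≤_; _<_; s≤s; _≤?_)
open import Data.Nat.Properties
open import Data.Nat.DivMod using (_mod_; _%_; [m+n]%n≡m%n)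
open import Data.Fin as Fin using (Fin; toℕ; fromℕ<; inject₁)
open import Data.Fin.Properties using (toℕ-injective; toℕ-fromℕ<; toℕ<n; toℕ-inject₁; any?)
  renaming (_≟_ to _≟ᶠ_)
open import Data.Product using (Σ; _×_; _,_; proj₁; proj₂)
open import Data.Sum using (_⊎_; inj₁; inj₂)
open import Data.List using (List; []; _∷_; _∷ʳ_; map; upTo)
open import Data.List.Properties using (upTo-∷ʳ; map-++)
open import Data.Bool using (true; false) renaming (_≟_ to _≟ᵇ_)
open import Data.Empty using (⊥; ⊥-elim)
open import Data.Unit using (tt)
open import Function using (id)
open import Relation.Nullary using (¬_; Dec; yes; no)
open import Relation.Nullary.Decidable using (¬¬-excluded-middle; _×-dec_)
open import Relation.Binary.PropositionalEquality

-- Parity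

pattern player₀ = Fin.zero
pattern player₁ = Fin.suc Fin.zero

opponent : Player → Player
opponent player₀ = player₁
opponent player₁ = player₀

opponent-involutive : ∀ p → opponent (opponent p) ≡ p
opponent-involutive player₀ = refl
opponent-involutive player₁ = refl

opponent-≢ : ∀ p → opponent p ≢ p
opponent-≢ player₀ ()
opponent-≢ player₁ ()

≢⇒≡opponent : ∀ {p q : Player} → p ≢ q → p ≡ opponent q
≢⇒≡opponent {player₀} {player₀} p≢q = ⊥-elim (p≢q refl)
≢⇒≡opponent {player₀} {player₁} _   = refl
≢⇒≡opponent {player₁} {player₀} _   = refl
≢⇒≡opponent {player₁} {player₁} p≢q = ⊥-elim (p≢q refl)

player₀≢player₁ : _≢_ {A = Player} player₀ player₁
player₀≢player₁ ()

parity : ℕ → Player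
parity zero    = player₀
parity (suc n) = opponent (parity n)

parity-pred : ∀ n {p} → parity (suc n) ≡ p → parity n ≡ opponent p
parity-pred n refl = sym (opponent-involutive (parity n))

parity-suc≢ : ∀ n → parity (suc n) ≢ parity n
parity-suc≢ n = opponent-≢ (parity n)

parity-suc≡⇒≢ : ∀ n m → parity (suc n) ≡ parity m → parity n ≢ parity m
parity-suc≡⇒≢ n m p1+n≡pm pn≡pm = parity-suc≢ n (trans p1+n≡pm (sym pn≡pm))

mod2≡parity : ∀ n → n mod 2 ≡ parity n
mod2≡parity zero          = refl
mod2≡parity (suc zero)    = refl
mod2≡parity (suc (suc n)) = begin
  suc (suc n) mod 2 ≡⟨ toℕ-injective (begin
    toℕ (suc (suc n) mod 2) ≡⟨ toℕ-fromℕ< _ ⟩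
    (2 + n) % 2             ≡⟨ cong (_% 2) (+-comm 2 n) ⟩
    (n + 2) % 2             ≡⟨ [m+n]%n≡m%n n 2 ⟩
    n % 2                   ≡⟨ toℕ-fromℕ< _ ⟨
    toℕ (n mod 2)           ∎) ⟩
  n mod 2                               ≡⟨ mod2≡parity n ⟩
  parity n                              ≡⟨ opponent-involutive (parity n) ⟨
  opponent (opponent (parity n))        ∎
  where open ≡-Reasoning

parity-double+ : ∀ m n → parity (m + m + n) ≡ parity n
parity-double+ zero    n = refl
parity-double+ (suc m) n = begin
  opponent (parity (m + suc m + n))            ≡⟨ cong (λ x → opponent (parity (x + n))) (+-suc m m) ⟩
  opponent (opponent (parity (m + m + n)))     ≡⟨ opponent-involutive _ ⟩
  parity (m + m + n)                           ≡⟨ parity-double+ m n ⟩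
  parity n                                     ∎
  where open ≡-Reasoning

parity-2*+ : ∀ m n → parity (2 * m + n) ≡ parity n
parity-2*+ m n = trans (cong (λ x → parity (m + x + n)) (+-identityʳ m)) (parity-double+ m n)

parity-2* : ∀ m → parity (2 * m) ≡ player₀
parity-2* m = trans (cong parity (sym (+-identityʳ (2 * m)))) (parity-2*+ m 0)

≤∧parity≢⇒< : ∀ {i m} → i ≤ m → parity i ≢ parity m → i < m
≤∧parity≢⇒< {i} i≤m pi≢pm with m≤n⇒m<n∨m≡n i≤m
... | inj₁ i<m  = i<m
... | inj₂ refl = ⊥-elim (pi≢pm refl)

≤suc∧parity≡⇒≤ : ∀ {i m} → i ≤ suc m → parity i ≡ parity m → i ≤ m
≤suc∧parity≡⇒≤ {i} {m} i≤1+m pi≡pm =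
  ≤-pred (≤∧parity≢⇒< i≤1+m λ pi≡p1+m → parity-suc≢ m (trans (sym pi≡p1+m) pi≡pm))

parity-gap : ∀ {i z} → parity i ≡ parity z → i < z → suc i < z
parity-gap {i} pi≡pz i<z = ≤∧parity≢⇒< i<z λ p1+i≡pz → parity-suc≢ i (trans p1+i≡pz (sym pi≡pz))

¬¬-decidable : ∀ {n} (P : Fin n → Set) → ¬ ¬ (∀ x → Dec (P x))
¬¬-decidable {zero}  P ¬dec = ¬dec (λ ())
¬¬-decidable {suc n} P ¬dec = ¬¬-excluded-middle λ dec₀ →
  ¬¬-decidable (λ x → P (Fin.suc x)) λ decₛ →
    ¬dec λ { Fin.zero → dec₀ ; (Fin.suc x) → decₛ x }

-- Traps and attractors

module Attractor (G : Game) where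
  open GameTheory G

  record IsTrap (℘ : Player) (S X T : Sub) : Set where
    field
      disjoint : ∀ v → T v → S v → ¬ X v
      closed   : ∀ v → T v → S v → owner v ≡ ℘ → ∀ u → Move v u → S u → T u
      escape   : ∀ v → T v → S v → owner v ≢ ℘ → Σ Pos λ u → Move v u × S u × T u

  trap⇒¬Attr : ∀ {℘ S X T} → IsTrap ℘ S X T → ∀ v → T v → ¬ Attr ℘ S X v
  trap⇒¬Attr trap v tv (base sv xv) = IsTrap.disjoint trap v tv sv xv
  trap⇒¬Attr trap v tv (own u sv ow mv su a) =
    trap⇒¬Attr trap u (IsTrap.closed trap v tv sv ow u mv su) a
  trap⇒¬Attr trap v tv (opp sv ¬ow all) with IsTrap.escape trap v tv sv ¬ow
  ... | u , mv , su , tu = trap⇒¬Attr trap u tu (all u mv su)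

  Attr-mono : ∀ {℘ S} {A B : Sub} → (∀ v → S v → A v → B v) →
              ∀ v → Attr ℘ S A v → Attr ℘ S B v
  Attr-mono A⊆B v (base sv a)            = base sv (A⊆B v sv a)
  Attr-mono A⊆B v (own u sv ow mv su a)  = own u sv ow mv su (Attr-mono A⊆B u a)
  Attr-mono A⊆B v (opp sv ¬ow all)       = opp sv ¬ow (λ u mv su → Attr-mono A⊆B u (all u mv su))

  -- The fallback is irrelevant: Legal only constrains positions with a move into S.
  moveInto : (S : Sub) → (∀ v → Dec (S v)) → Pos → Pos
  moveInto S S? v with any? (λ u → (E v u ≟ᵇ true) ×-dec S? u)
  ... | yes (u , _) = u
  ... | no _        = v

  moveInto-legal : ∀ S S? v → Σ Pos (λ u → Move v u × S u) →
                   Move v (moveInto S S? v) × S (moveInto S S? v)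
  moveInto-legal S S? v (u , mv , su) with any? (λ u → (E v u ≟ᵇ true) ×-dec S? u)
  ... | yes (_ , legal) = legal
  ... | no ¬legal       = ⊥-elim (¬legal (u , mv , su))

  preferring : (S : Sub) → (∀ v → Dec (S v)) → Pos → Strategy
  preferring S S? t _ v with E v t
  ... | true  = t
  ... | false = moveInto S S? v

  preferring-target : ∀ S S? t h v → Move v t → preferring S S? t h v ≡ t
  preferring-target S S? t h v mv with E v t
  ... | true = refl
  preferring-target S S? t h v () | false

  preferring-legal : ∀ ℘ S S? t → S t → Legal ℘ S (preferring S S? t)
  preferring-legal ℘ S S? t st h v _ _ someMove with E v t in mv
  ... | true  = mv , st
  ... | false = moveInto-legal S S? v someMove

-- Core extensions

module CoreExtension {k : ℕ} (X : CoreExt k) where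
  open CoreExt X
  open Tree X
  open Attractor G

  Index : Set
  Index = Fin (suc (2 * k))

  index : CorePos k → ℕ
  index (_ , i) = toℕ i

  toℕ≤2k : (i : Index) → toℕ i ≤ 2 * k
  toℕ≤2k i = ≤-pred (toℕ<n i)

  toIndex : (m : ℕ) → m ≤ 2 * k → Index
  toIndex m m≤2k = fromℕ< (s≤s m≤2k)

  toℕ-toIndex : ∀ m m≤2k → toℕ (toIndex m m≤2k) ≡ m
  toℕ-toIndex m m≤2k = toℕ-fromℕ< (s≤s m≤2k)

  core⊎InP : ∀ v → (Σ (CorePos k) λ c → ι c ≡ v) ⊎ InP v
  core⊎InP v with any? (λ i → ι (kα , i) ≟ᶠ v) | any? (λ i → ι (kβ , i) ≟ᶠ v)
                | any? (λ i → ι (kγ , i) ≟ᶠ v)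
  ... | yes (i , e) | _           | _           = inj₁ ((kα , i) , e)
  ... | no _        | yes (i , e) | _           = inj₁ ((kβ , i) , e)
  ... | no _        | no _        | yes (i , e) = inj₁ ((kγ , i) , e)
  ... | no ¬α       | no ¬β       | no ¬γ       =
    inj₂ λ { (kα , i) e → ¬α (i , e) ; (kβ , i) e → ¬β (i , e) ; (kγ , i) e → ¬γ (i , e) }

  coreOwnerᵖ : CorePos k → Player
  coreOwnerᵖ (kα , i) = parity (toℕ i)
  coreOwnerᵖ (kβ , i) = parity (toℕ i)
  coreOwnerᵖ (kγ , i) = parity (suc (toℕ i))

  owner-ι : ∀ c → owner (ι c) ≡ coreOwnerᵖ c
  owner-ι (kα , i) = trans (ι-owner (kα , i)) (mod2≡parity (toℕ i))
  owner-ι (kβ , i) = trans (ι-owner (kβ , i)) (mod2≡parity (toℕ i))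
  owner-ι (kγ , i) = trans (ι-owner (kγ , i)) (mod2≡parity (suc (toℕ i)))

  move⇒CoreE : ∀ {c d} → Move (ι c) (ι d) → CoreE {k} c d
  move⇒CoreE {c} {d} = proj₁ (ι-E c d)

  CoreE⇒move : ∀ {c d} → CoreE {k} c d → Move (ι c) (ι d)
  CoreE⇒move {c} {d} = proj₂ (ι-E c d)

  P-owner : ∀ {i v} → InP v → Move (ι (kγ , i)) v → owner v ≡ parity (toℕ i)
  P-owner {i} {v} v∈P mv = trans (proj₁ (P-γ i v v∈P mv)) (mod2≡parity (toℕ i))

  P-back : ∀ {i v} → InP v → Move (ι (kγ , i)) v → Move v (ι (kγ , i))
  P-back {i} {v} v∈P mv = proj₁ (proj₂ (P-γ i v v∈P mv))

  P-pr≤ : ∀ {i v} → InP v → Move (ι (kγ , i)) v → pr v ≤ toℕ i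
  P-pr≤ {i} {v} v∈P mv = proj₂ (proj₂ (P-γ i v v∈P mv))

  true≢false : true ≢ false
  true≢false ()

  successor-of-core : ∀ c u → Move (ι c) u →
    (Σ (CorePos k) λ d → ι d ≡ u × CoreE {k} c d) ⊎ (InP u × Σ Index λ i → c ≡ (kγ , i))
  successor-of-core c u mv with core⊎InP u
  ... | inj₁ (d , refl) = inj₁ (d , refl , move⇒CoreE mv)
  successor-of-core (kα , i) u mv | inj₂ u∈P = ⊥-elim (true≢false (trans (sym mv) (proj₁ (P-α i u u∈P))))
  successor-of-core (kβ , i) u mv | inj₂ u∈P = ⊥-elim (true≢false (trans (sym mv) (proj₁ (P-β i u u∈P))))
  successor-of-core (kγ , i) u mv | inj₂ u∈P = inj₂ (u∈P , i , refl)

  record IsCoreTrap (℘ : Player) (S Y : Sub) (T : CorePos k → Set) : Set where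
    field
      inside    : ∀ c → T c → S (ι c)
      disjoint  : ∀ c → T c → ¬ Y (ι c)
      disjointᴾ : ∀ v i → InP v → owner v ≢ ℘ → T (kγ , i) → Move (ι (kγ , i)) v → ¬ Y v
      closed    : ∀ c d → T c → coreOwnerᵖ c ≡ ℘ → CoreE {k} c d → S (ι d) → T d
      escape    : ∀ c → T c → coreOwnerᵖ c ≢ ℘ → Σ (CorePos k) λ d → CoreE {k} c d × T d

  -- A ℘-owned γ_i only moves into P-positions of the opponent (condition (iv)), who can move
  -- back to γ_i; so these P-positions extend the core trap to a trap of the whole game.
  coreTrap⇒¬Attr : ∀ {℘ S Y T} → IsCoreTrap ℘ S Y T → ∀ c → T c → ¬ Attr ℘ S Y (ι c)
  coreTrap⇒¬Attr {℘} {S} {Y} {T} trap c tc = trap⇒¬Attr isTrap (ι c) (inj₁ (c , refl , tc))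
    where
      open IsCoreTrap trap

      T⁺ : Sub
      T⁺ v = (Σ (CorePos k) λ c → ι c ≡ v × T c) ⊎
             (InP v × owner v ≢ ℘ × Σ Index λ i → T (kγ , i) × Move (ι (kγ , i)) v)

      closed⁺ : ∀ v → T⁺ v → S v → owner v ≡ ℘ → ∀ u → Move v u → S u → T⁺ u
      closed⁺ v (inj₂ (_ , ¬ow , _)) _ ow = ⊥-elim (¬ow ow)
      closed⁺ v (inj₁ (c , refl , tc)) _ ow u mv su with successor-of-core c u mv
      ... | inj₁ (d , refl , c→d) = inj₁ (d , refl , closed c d tc (trans (sym (owner-ι c)) ow) c→d su)
      ... | inj₂ (u∈P , i , refl) = inj₂ (u∈P , ¬ow , i , tc , mv)
        where
          ¬ow : owner u ≢ ℘
          ¬ow ow′ = parity-suc≢ (toℕ i)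
            (trans (sym (owner-ι (kγ , i))) (trans ow (trans (sym ow′) (P-owner u∈P mv))))

      escape⁺ : ∀ v → T⁺ v → S v → owner v ≢ ℘ → Σ Pos λ u → Move v u × S u × T⁺ u
      escape⁺ v (inj₁ (c , refl , tc)) _ ¬ow with escape c tc (λ ow → ¬ow (trans (owner-ι c) ow))
      ... | d , c→d , td = ι d , CoreE⇒move c→d , inside d td , inj₁ (d , refl , td)
      escape⁺ v (inj₂ (v∈P , _ , i , tγ , mv)) _ _ =
        ι (kγ , i) , P-back v∈P mv , inside (kγ , i) tγ , inj₁ ((kγ , i) , refl , tγ)

      isTrap : IsTrap ℘ S Y T⁺
      isTrap = record
        { disjoint = λ { v (inj₁ (c , refl , tc)) _ → disjoint c tc
                       ; v (inj₂ (v∈P , ¬ow , i , tγ , mv)) _ → disjointᴾ v i v∈P ¬ow tγ mv }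
        ; closed   = closed⁺
        ; escape   = escape⁺
        }

  ContainsCore : Sub → ℕ → Set
  ContainsCore S m = ∀ c → index c ≤ m → S (ι c)

  NoAlphaAbove : Sub → ℕ → Set
  NoAlphaAbove S m = ∀ j → m < toℕ j → ¬ S (ι (kα , j))

  IsAlpha : ℕ → CorePos k → Set
  IsAlpha m (kα , j) = toℕ j ≡ m
  IsAlpha m (kβ , _) = ⊥
  IsAlpha m (kγ , _) = ⊥

  IsAlpha⇒index≡ : ∀ {m} c → IsAlpha m c → index c ≡ m
  IsAlpha⇒index≡ (kα , _) j≡m = j≡m

  Alpha-ι⇒IsAlpha : ∀ {m} c → Alpha m (ι c) → IsAlpha m c
  Alpha-ι⇒IsAlpha c (j , j≡m , e) with ι-inj (kα , j) c e
  ... | refl = j≡m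

  Alpha-InP : ∀ {m v} → InP v → ¬ Alpha m v
  Alpha-InP v∈P (j , _ , e) = v∈P (kα , j) e

  Attr₁-α-avoids-core : ∀ S Z → parity Z ≡ player₀ → ContainsCore S Z → NoAlphaAbove S Z →
                        ∀ c → index c ≤ Z → ¬ IsAlpha Z c → ¬ Attr player₁ S (Alpha Z) (ι c)
  Attr₁-α-avoids-core S Z pZ core noα c c≤Z ¬α = coreTrap⇒¬Attr trap c (c≤Z , ¬α)
    where
      T : CorePos k → Set
      T c = index c ≤ Z × ¬ IsAlpha Z c

      closed : ∀ c d → T c → coreOwnerᵖ c ≡ player₁ → CoreE {k} c d → S (ι d) → T d
      closed _ _ (i≤Z , _) _ (αβ i)         _ = i≤Z , λ ()
      closed _ _ (i≤Z , _) _ (βγ i)         _ = i≤Z , λ ()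
      closed _ _ (i≤Z , _) _ (γγ i)         _ = i≤Z , λ ()
      closed _ _ (i≤Z , _) _ (γβ i)         _ = i≤Z , λ ()
      closed _ _ (i≤Z , _) _ (βα i j i≡1+j) _ = <⇒≤ j<Z , <⇒≢ j<Z
        where j<Z = subst (_≤ Z) i≡1+j i≤Z
      closed _ _ (i≤Z , _) ow (γα i j j≡1+i) sα with m≤n⇒m<n∨m≡n i≤Z
      ... | inj₂ refl = ⊥-elim (noα j (≤-reflexive (sym j≡1+i)) sα)
      ... | inj₁ i<Z  = <⇒≤ j<Z , <⇒≢ j<Z
        where j<Z = subst (_< Z) (sym j≡1+i) (parity-gap (trans (parity-pred (toℕ i) ow) (sym pZ)) i<Z)

      escape : ∀ c → T c → coreOwnerᵖ c ≢ player₁ → Σ (CorePos k) λ d → CoreE {k} c d × T d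
      escape (kα , i) (i≤Z , _) _ = (kβ , i) , αβ i , i≤Z , λ ()
      escape (kβ , i) (i≤Z , _) _ = (kγ , i) , βγ i , i≤Z , λ ()
      escape (kγ , i) (i≤Z , _) _ = (kγ , i) , γγ i , i≤Z , λ ()

      trap : IsCoreTrap player₁ S (Alpha Z) T
      trap = record
        { inside    = λ c t → core c (proj₁ t)
        ; disjoint  = λ c t α → proj₂ t (Alpha-ι⇒IsAlpha c α)
        ; disjointᴾ = λ v _ v∈P _ _ _ → Alpha-InP v∈P
        ; closed    = closed
        ; escape    = escape
        }

  Attr₀-α-avoids-core : ∀ S Z → parity Z ≡ player₀ → ContainsCore S Z →
                        ∀ c → index c ≤ Z → ¬ Attr player₀ S (Alpha (suc Z)) (ι c)
  Attr₀-α-avoids-core S Z pZ core = coreTrap⇒¬Attr trap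
    where
      T : CorePos k → Set
      T c = index c ≤ Z

      closed : ∀ c d → T c → coreOwnerᵖ c ≡ player₀ → CoreE {k} c d → S (ι d) → T d
      closed _ _ i≤Z _  (αβ i)         _ = i≤Z
      closed _ _ i≤Z _  (βγ i)         _ = i≤Z
      closed _ _ i≤Z _  (γγ i)         _ = i≤Z
      closed _ _ i≤Z _  (γβ i)         _ = i≤Z
      closed _ _ i≤Z _  (βα i j i≡1+j) _ = <⇒≤ (subst (_≤ Z) i≡1+j i≤Z)
      closed _ _ i≤Z ow (γα i j j≡1+i) _ =
        subst (_≤ Z) (sym j≡1+i) (≤∧parity≢⇒< i≤Z (parity-suc≡⇒≢ (toℕ i) Z (trans ow (sym pZ))))

      escape : ∀ c → T c → coreOwnerᵖ c ≢ player₀ → Σ (CorePos k) λ d → CoreE {k} c d × T d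
      escape (kα , i) i≤Z _ = (kβ , i) , αβ i , i≤Z
      escape (kβ , i) i≤Z _ = (kγ , i) , βγ i , i≤Z
      escape (kγ , i) i≤Z _ = (kγ , i) , γγ i , i≤Z

      trap : IsCoreTrap player₀ S (Alpha (suc Z)) T
      trap = record
        { inside    = core
        ; disjoint  = λ c c≤Z α → 1+n≰n (subst (_≤ Z) (IsAlpha⇒index≡ c (Alpha-ι⇒IsAlpha c α)) c≤Z)
        ; disjointᴾ = λ v _ v∈P _ _ _ → Alpha-InP v∈P
        ; closed    = closed
        ; escape    = escape
        }

  LowerCore : ℕ → CorePos k → Set
  LowerCore m (kα , i) = toℕ i ≤ suc m
  LowerCore m (kβ , i) = toℕ i ≤ suc m
  LowerCore m (kγ , i) = toℕ i ≤ m

  LowerCore⇒≤ : ∀ {m} c → LowerCore m c → index c ≤ suc m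
  LowerCore⇒≤ (kα , i) i≤1+m = i≤1+m
  LowerCore⇒≤ (kβ , i) i≤1+m = i≤1+m
  LowerCore⇒≤ (kγ , i) i≤m   = ≤-trans i≤m (n≤1+n _)

  ≤⇒LowerCore : ∀ {m} c → index c ≤ m → LowerCore m c
  ≤⇒LowerCore (kα , i) i≤m = ≤-trans i≤m (n≤1+n _)
  ≤⇒LowerCore (kβ , i) i≤m = ≤-trans i≤m (n≤1+n _)
  ≤⇒LowerCore (kγ , i) i≤m = i≤m

  Attr₀-avoids-LowerCore : ∀ S Y m → parity m ≡ player₀ → ContainsCore S (suc m) →
    (∀ c → LowerCore m c → ¬ Y (ι c)) →
    (∀ v i → InP v → owner v ≢ player₀ → toℕ i ≤ m → Move (ι (kγ , i)) v → ¬ Y v) →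
    ∀ c → LowerCore m c → ¬ Attr player₀ S Y (ι c)
  Attr₀-avoids-LowerCore S Y m pm core disjoint disjointᴾ = coreTrap⇒¬Attr trap
    where
      closed : ∀ c d → LowerCore m c → coreOwnerᵖ c ≡ player₀ → CoreE {k} c d → S (ι d) →
               LowerCore m d
      closed _ _ i≤1+m _  (αβ i)         _ = i≤1+m
      closed _ _ i≤1+m ow (βγ i)         _ = ≤suc∧parity≡⇒≤ i≤1+m (trans ow (sym pm))
      closed _ _ i≤1+m _  (βα i j i≡1+j) _ = m≤n⇒m≤1+n (≤-pred (subst (_≤ suc m) i≡1+j i≤1+m))
      closed _ _ i≤m   _  (γγ i)         _ = i≤m
      closed _ _ i≤m   _  (γβ i)         _ = m≤n⇒m≤1+n i≤m
      closed _ _ i≤m   ow (γα i j j≡1+i) _ = m≤n⇒m≤1+n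
        (subst (_≤ m) (sym j≡1+i) (≤∧parity≢⇒< i≤m (parity-suc≡⇒≢ (toℕ i) m (trans ow (sym pm)))))

      escape : ∀ c → LowerCore m c → coreOwnerᵖ c ≢ player₀ →
               Σ (CorePos k) λ d → CoreE {k} c d × LowerCore m d
      escape (kα , i)          i≤1+m _  = (kβ , i) , αβ i , i≤1+m
      escape (kβ , Fin.zero)   _     ¬ow = ⊥-elim (¬ow refl)
      escape (kβ , Fin.suc i)  i≤1+m _  =
        (kα , inject₁ i) , βα (Fin.suc i) (inject₁ i) (cong suc (sym (toℕ-inject₁ i))) ,
        ≤-trans (≤-reflexive (toℕ-inject₁ i)) (m≤n⇒m≤1+n (≤-pred i≤1+m))
      escape (kγ , i)          i≤m   _  = (kγ , i) , γγ i , i≤m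

      trap : IsCoreTrap player₀ S Y (LowerCore m)
      trap = record
        { inside    = λ c t → core c (LowerCore⇒≤ c t)
        ; disjoint  = disjoint
        ; disjointᴾ = disjointᴾ
        ; closed    = closed
        ; escape    = escape
        }

  -- Priorities and f_L

  pr-α : ∀ j → pr (ι (kα , j)) ≡ suc (2 * k + toℕ j)
  pr-α j = trans (ι-pr (kα , j)) (+-comm (2 * k + toℕ j) 1)

  pr-InP≤2k : ∀ {v} → InP v → pr v ≤ 2 * k
  pr-InP≤2k {v} v∈P = ≤-pred (subst (suc (pr v) ≤_) (+-comm (2 * k) 1) (P-pr v v∈P))

  α⊎pr≤2k : ∀ v → (Σ Index λ j → ι (kα , j) ≡ v) ⊎ pr v ≤ 2 * k
  α⊎pr≤2k v with core⊎InP v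
  ... | inj₁ ((kα , j) , e)    = inj₁ (j , e)
  ... | inj₁ ((kβ , j) , refl) = inj₂ (subst (_≤ 2 * k) (sym (ι-pr (kβ , j))) (toℕ≤2k j))
  ... | inj₁ ((kγ , j) , refl) = inj₂ (subst (_≤ 2 * k) (sym (ι-pr (kγ , j))) (toℕ≤2k j))
  ... | inj₂ v∈P               = inj₂ (pr-InP≤2k v∈P)

  pr≡top⇒Alpha : ∀ M v → pr v ≡ suc (2 * k + M) → Alpha M v
  pr≡top⇒Alpha M v pv≡top with α⊎pr≤2k v
  ... | inj₁ (j , refl) = j , +-cancelˡ-≡ (2 * k) _ _ (suc-injective (trans (sym (pr-α j)) pv≡top)) , refl
  ... | inj₂ pv≤2k      = ⊥-elim (<⇒≱ (s≤s (m≤m+n (2 * k) M)) (subst (_≤ 2 * k) pv≡top pv≤2k))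

  Alpha⇒pr≡top : ∀ M v → Alpha M v → pr v ≡ suc (2 * k + M)
  Alpha⇒pr≡top M v (j , refl , refl) = pr-α j

  pr≤top : ∀ S M → NoAlphaAbove S M → ∀ v → S v → pr v ≤ suc (2 * k + M)
  pr≤top S M noα v sv with α⊎pr≤2k v
  ... | inj₂ pv≤2k      = ≤-trans pv≤2k (≤-trans (m≤m+n (2 * k) M) (n≤1+n _))
  ... | inj₁ (j , refl) with toℕ j ≤? M
  ...   | yes j≤M = subst (_≤ suc (2 * k + M)) (sym (pr-α j)) (s≤s (+-monoʳ-≤ (2 * k) j≤M))
  ...   | no j≰M  = ⊥-elim (noα j (≰⇒> j≰M) sv)

  FL-topAlpha : ∀ S ℘ M (g : Index) → toℕ g ≡ M → S (ι (kα , g)) → NoAlphaAbove S M →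
                ℘ ≡ parity (suc M) → FL S (S ∖ Attr ℘ S (Alpha M)) ℘
  FL-topAlpha S ℘ M g g≡M sα noα ℘≡ = suc (2 * k + M) , isMax , parity-top , sameSet
    where
      isMax : IsMaxPr S (suc (2 * k + M))
      isMax = (ι (kα , g) , sα , Alpha⇒pr≡top M _ (g , g≡M , refl)) , pr≤top S M noα

      parity-top : ℘ ≡ suc (2 * k + M) mod 2
      parity-top = begin
        ℘                                ≡⟨ ℘≡ ⟩
        opponent (parity M)              ≡⟨ cong opponent (parity-2*+ k M) ⟨
        parity (suc (2 * k + M))         ≡⟨ mod2≡parity (suc (2 * k + M)) ⟨
        suc (2 * k + M) mod 2            ∎
        where open ≡-Reasoning

      sameSet : (S ∖ Attr ℘ S (Alpha M)) ≐ (S ∖ Attr ℘ S (λ v → S v × pr v ≡ suc (2 * k + M)))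
      sameSet v = (λ (sv , ¬a) → sv , λ a → ¬a (Attr-mono (λ u _ top → pr≡top⇒Alpha M u (proj₂ top)) v a))
                , (λ (sv , ¬a) → sv , λ a → ¬a (Attr-mono (λ u su α → su , Alpha⇒pr≡top M u α) v a))

  -- Winning regions of G'_{wL}

  γ-even∈W0 : ∀ S → (∀ v → Dec (S v)) → (g : Index) → parity (toℕ g) ≡ player₀ →
              S (ι (kγ , g)) → NoAlphaAbove S (toℕ g) → W0 S (ι (kγ , g))
  γ-even∈W0 S S? g pg sγ noα = sγ , σ , preferring-legal player₀ S S? γ sγ , wins
    where
      γ β : Pos
      γ = ι (kγ , g)
      β = ι (kβ , g)

      σ : Strategy
      σ = preferring S S? γ

      Back : Pos → Set
      Back v = v ≡ β ⊎ (InP v × Move γ v)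

      Back-owner : ∀ {v} → Back v → owner v ≡ player₀
      Back-owner (inj₁ refl)        = trans (owner-ι (kβ , g)) pg
      Back-owner (inj₂ (v∈P , mv))  = trans (P-owner v∈P mv) pg

      Back-move : ∀ {v} → Back v → Move v γ
      Back-move (inj₁ refl)        = CoreE⇒move (βγ g)
      Back-move (inj₂ (v∈P , mv))  = P-back v∈P mv

      Back-pr≤ : ∀ {v} → Back v → pr v ≤ toℕ g
      Back-pr≤ (inj₁ refl)        = ≤-reflexive (ι-pr (kβ , g))
      Back-pr≤ (inj₂ (v∈P , mv))  = P-pr≤ v∈P mv

      wins : ∀ π → Consistent player₀ S σ γ π → Wins0 π
      wins π (π0 , πS , πM , πσ) = toℕ g , trans (mod2≡parity (toℕ g)) pg , often , 0 , λ t _ → pr≤ t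
        where
          returns : ∀ t → Back (π t) → π (suc t) ≡ γ
          returns t b = trans (πσ t (Back-owner b))
                              (preferring-target S S? γ (map π (upTo t)) (π t) (Back-move b))

          near : ∀ t → π t ≡ γ ⊎ Back (π t)
          near zero = inj₁ π0
          near (suc t) with near t
          ... | inj₂ b = inj₁ (returns t b)
          ... | inj₁ e with successor-of-core (kγ , g) (π (suc t)) (subst (λ v → Move v (π (suc t))) e (πM t))
          ...   | inj₁ (_ , e′ , γγ _)         = inj₁ (sym e′)
          ...   | inj₁ (_ , e′ , γβ _)         = inj₂ (inj₁ (sym e′))
          ...   | inj₁ (_ , e′ , γα _ j j≡1+g) =
                    ⊥-elim (noα j (≤-reflexive (sym j≡1+g)) (subst S (sym e′) (πS (suc t))))
          ...   | inj₂ (v∈P , _)               =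
                    inj₂ (inj₂ (v∈P , subst (λ v → Move v (π (suc t))) e (πM t)))

          pr-γ : pr γ ≡ toℕ g
          pr-γ = ι-pr (kγ , g)

          pr≤ : ∀ t → pr (π t) ≤ toℕ g
          pr≤ t with near t
          ... | inj₁ e = ≤-reflexive (trans (cong pr e) pr-γ)
          ... | inj₂ b = Back-pr≤ b

          often : ∀ N → Σ ℕ λ t → N ≤ t × pr (π t) ≡ toℕ g
          often N with near N
          ... | inj₁ e = N , ≤-refl , trans (cong pr e) pr-γ
          ... | inj₂ b = suc N , n≤1+n N , trans (cong pr (returns N b)) pr-γ

  α>2k : ∀ j → 2 * k < pr (ι (kα , j))
  α>2k j = subst (2 * k <_) (sym (pr-α j)) (s≤s (m≤m+n (2 * k) (toℕ j)))

  -- Only used for i < 2k; for i = 2k the value is an arbitrary placeholder.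
  nextα : Index → Pos
  nextα i with suc (toℕ i) ≤? 2 * k
  ... | yes 1+i≤2k = ι (kα , toIndex (suc (toℕ i)) 1+i≤2k)
  ... | no _       = ι (kγ , i)

  nextα-spec : ∀ i → suc (toℕ i) ≤ 2 * k →
               Σ Index λ j → toℕ j ≡ suc (toℕ i) × nextα i ≡ ι (kα , j)
  nextα-spec i 1+i≤2k with suc (toℕ i) ≤? 2 * k
  ... | yes le   = toIndex (suc (toℕ i)) le , toℕ-toIndex (suc (toℕ i)) le , refl
  ... | no 1+i≰2k = ⊥-elim (1+i≰2k 1+i≤2k)

  counterCore : CorePos k → Pos
  counterCore (kα , i) = ι (kβ , i)
  counterCore (kβ , i) = ι (kγ , i)
  counterCore (kγ , i) = nextα i

  -- From a P-position, player 1 returns to the previous position (the γ it was entered from).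
  counter : Pos → Pos → Pos
  counter prev v with core⊎InP v
  ... | inj₁ (c , _) = counterCore c
  ... | inj₂ _       = prev

  counter-ι : ∀ prev c → counter prev (ι c) ≡ counterCore c
  counter-ι prev c with core⊎InP (ι c)
  ... | inj₁ (c′ , e) = cong counterCore (ι-inj c′ c e)
  ... | inj₂ ι∈P      = ⊥-elim (ι∈P c refl)

  counter-InP : ∀ prev {v} → InP v → counter prev v ≡ prev
  counter-InP prev {v} v∈P with core⊎InP v
  ... | inj₁ (c , e) = ⊥-elim (v∈P c e)
  ... | inj₂ _       = refl

  module Counterplay (S : Sub) (m : ℕ) (pm : parity m ≡ player₀) (m+2≤2k : suc (suc m) ≤ 2 * k)
                     (core : ContainsCore S (suc m)) (noα : NoAlphaAbove S (suc m)) where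

    -- The positions, paired with their predecessors, visited while player 1 follows counter.
    data Region (prev v : Pos) : Set where
      inCore  : ∀ c → ι c ≡ v → index c ≤ suc m → Region prev v
      outside : ∀ i → InP v → parity (toℕ i) ≡ player₁ → toℕ i ≤ suc m →
                ι (kγ , i) ≡ prev → Move (ι (kγ , i)) v → S v → Region prev v

    Region⇒S : ∀ {prev v} → Region prev v → S v
    Region⇒S (inCore c refl c≤1+m)         = core c c≤1+m
    Region⇒S (outside _ _ _ _ _ _ sv)      = sv

    successor-index : ∀ {c d} → index c ≤ suc m → CoreE {k} c d → S (ι d) → index d ≤ suc m
    successor-index i≤1+m (αβ i)         _  = i≤1+m
    successor-index i≤1+m (βγ i)         _  = i≤1+m
    successor-index i≤1+m (γγ i)         _  = i≤1+m
    successor-index i≤1+m (γβ i)         _  = i≤1+m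
    successor-index i≤1+m (βα i j i≡1+j) _  = ≤-trans (n≤1+n _) (subst (_≤ suc m) i≡1+j i≤1+m)
    successor-index i≤1+m (γα i j _)     sα with toℕ j ≤? suc m
    ... | yes j≤1+m = j≤1+m
    ... | no j≰1+m  = ⊥-elim (noα j (≰⇒> j≰1+m) sα)

    module Against (σ : Strategy) (legal : Legal player₀ S σ) where

      next : List Pos → Pos → Pos → Pos
      next h prev v with owner v ≟ᶠ player₀
      ... | yes _ = σ h v
      ... | no _  = counter prev v

      next-σ : ∀ h prev v → owner v ≡ player₀ → next h prev v ≡ σ h v
      next-σ h prev v ow with owner v ≟ᶠ player₀
      ... | yes _ = refl
      ... | no ¬ow = ⊥-elim (¬ow ow)

      next-counter : ∀ h prev v → owner v ≢ player₀ → next h prev v ≡ counter prev v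
      next-counter h prev v ¬ow with owner v ≟ᶠ player₀
      ... | yes ow = ⊥-elim (¬ow ow)
      ... | no _   = refl

      σ-step : ∀ h c → index c ≤ suc m → owner (ι c) ≡ player₀ →
               Region (ι c) (σ h (ι c)) × Move (ι c) (σ h (ι c))
      σ-step h c c≤1+m ow with legal h (ι c) (core c c≤1+m) ow (someMove c c≤1+m)
        where
          someMove : ∀ c → index c ≤ suc m → Σ Pos λ u → Move (ι c) u × S u
          someMove (kα , i) i≤1+m = ι (kβ , i) , CoreE⇒move (αβ i) , core (kβ , i) i≤1+m
          someMove (kβ , i) i≤1+m = ι (kγ , i) , CoreE⇒move (βγ i) , core (kγ , i) i≤1+m
          someMove (kγ , i) i≤1+m = ι (kγ , i) , CoreE⇒move (γγ i) , core (kγ , i) i≤1+m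
      ... | mv , sσ with successor-of-core c _ mv
      ...   | inj₁ (d , e , c→d)   = inCore d e (successor-index c≤1+m c→d (subst S (sym e) sσ)) , mv
      ...   | inj₂ (v∈P , i , refl) =
              outside i v∈P (parity-pred (toℕ i) (trans (sym (owner-ι (kγ , i))) ow)) c≤1+m refl mv sσ , mv

      counter-step : ∀ c → index c ≤ suc m → coreOwnerᵖ c ≢ player₀ →
                     Region (ι c) (counterCore c) × Move (ι c) (counterCore c)
      counter-step (kα , i) i≤1+m _ = inCore (kβ , i) refl i≤1+m , CoreE⇒move (αβ i)
      counter-step (kβ , i) i≤1+m _ = inCore (kγ , i) refl i≤1+m , CoreE⇒move (βγ i)
      counter-step (kγ , i) i≤1+m ¬ow =
        counter-γ-step i (≤suc∧parity≡⇒≤ i≤1+m (trans (parity-pred (toℕ i) (≢⇒≡opponent ¬ow)) (sym pm)))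
        where
          counter-γ-step : ∀ i → toℕ i ≤ m →
                           Region (ι (kγ , i)) (nextα i) × Move (ι (kγ , i)) (nextα i)
          counter-γ-step i i≤m with nextα-spec i (≤-trans (s≤s i≤m) (≤-trans (n≤1+n _) m+2≤2k))
          ... | j , j≡1+i , e = subst (λ v → Region _ v × Move _ v) (sym e)
                  (inCore (kα , j) refl (subst (_≤ suc m) (sym j≡1+i) (s≤s i≤m)) ,
                   CoreE⇒move (γα i j j≡1+i))

      step : ∀ h {prev v} → Region prev v → Region v (next h prev v) × Move v (next h prev v)
      step h {prev} {v} r with owner v ≟ᶠ player₀ | r
      ... | yes ow | inCore c refl c≤1+m = σ-step h c c≤1+m ow
      ... | yes ow | outside i v∈P pi _ refl mv _ =
            ⊥-elim (player₀≢player₁ (trans (sym ow) (trans (P-owner v∈P mv) pi)))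
      ... | no ¬ow | inCore c refl c≤1+m =
            subst (λ u → Region (ι c) u × Move (ι c) u) (sym (counter-ι prev c))
              (counter-step c c≤1+m λ e → ¬ow (trans (owner-ι c) e))
      ... | no ¬ow | outside i v∈P _ i≤1+m refl mv _ =
            subst (λ u → Region v u × Move v u) (sym (counter-InP prev v∈P))
              (inCore (kγ , i) refl i≤1+m , P-back v∈P mv)

      module Play (prev₀ v₀ : Pos) (r₀ : Region prev₀ v₀) where

        -- history, previous position, current position
        State : Set
        State = List Pos × Pos × Pos

        state : ℕ → State
        state zero    = [] , prev₀ , v₀
        state (suc t) with state t
        ... | h , p , c = h ∷ʳ c , c , next h p c

        history : ℕ → List Pos
        history t = proj₁ (state t)

        prev π : ℕ → Pos
        prev t = proj₁ (proj₂ (state t))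
        π t    = proj₂ (proj₂ (state t))

        π-suc : ∀ t → π (suc t) ≡ next (history t) (prev t) (π t)
        π-suc t with state t
        ... | _ = refl

        prev-suc : ∀ t → prev (suc t) ≡ π t
        prev-suc t with state t
        ... | _ = refl

        history-suc : ∀ t → history (suc t) ≡ history t ∷ʳ π t
        history-suc t with state t
        ... | _ = refl

        history≡ : ∀ t → history t ≡ map π (upTo t)
        history≡ zero    = refl
        history≡ (suc t) = begin
          history (suc t)             ≡⟨ history-suc t ⟩
          history t ∷ʳ π t            ≡⟨ cong (_∷ʳ π t) (history≡ t) ⟩
          map π (upTo t) ∷ʳ π t       ≡⟨ map-++ π (upTo t) (t ∷ []) ⟨
          map π (upTo t ∷ʳ t)         ≡⟨ cong (map π) (upTo-∷ʳ t) ⟩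
          map π (upTo (suc t))        ∎
          where open ≡-Reasoning

        region : ∀ t → Region (prev t) (π t)
        region zero    = r₀
        region (suc t) =
          subst₂ Region (sym (prev-suc t)) (sym (π-suc t)) (proj₁ (step (history t) (region t)))

        move : ∀ t → Move (π t) (π (suc t))
        move t = subst (Move (π t)) (sym (π-suc t)) (proj₂ (step (history t) (region t)))

        consistent : Consistent player₀ S σ v₀ π
        consistent = refl , (λ t → Region⇒S (region t)) , move ,
          λ t ow → trans (π-suc t) (trans (next-σ (history t) (prev t) (π t) ow)
                                          (cong (λ h → σ h (π t)) (history≡ t)))

        move-from : ∀ t {v} → π t ≡ v → Move v (π (suc t))
        move-from t e = subst (λ v → Move v (π (suc t))) e (move t)

        region-index : ∀ t c → π t ≡ ι c → index c ≤ suc m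
        region-index t c e with region t
        ... | inCore d e′ d≤1+m       = subst (λ x → index x ≤ suc m) (ι-inj d c (trans e′ e)) d≤1+m
        ... | outside _ π∈P _ _ _ _ _ = ⊥-elim (π∈P c (sym e))

        after-counter : ∀ t → owner (π t) ≢ player₀ → π (suc t) ≡ counter (prev t) (π t)
        after-counter t ¬ow = trans (π-suc t) (next-counter (history t) (prev t) (π t) ¬ow)

        after-counterCore : ∀ t c → π t ≡ ι c → coreOwnerᵖ c ≢ player₀ → π (suc t) ≡ counterCore c
        after-counterCore t c e ¬ow = begin
          π (suc t)                   ≡⟨ after-counter t ¬ow′ ⟩
          counter (prev t) (π t)      ≡⟨ cong (counter (prev t)) e ⟩
          counter (prev t) (ι c)      ≡⟨ counter-ι (prev t) c ⟩
          counterCore c               ∎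
          where
            open ≡-Reasoning
            ¬ow′ : owner (π t) ≢ player₀
            ¬ow′ ow = ¬ow (trans (sym (owner-ι c)) (trans (cong owner (sym e)) ow))

        after-α : ∀ t {i} → π t ≡ ι (kα , i) → π (suc t) ≡ ι (kβ , i)
        after-α t {i} e with successor-of-core (kα , i) (π (suc t)) (move-from t e)
        ... | inj₁ (_ , e′ , αβ _) = sym e′
        ... | inj₂ (_ , _ , ())

        after-β₁ : ∀ t {i} → π t ≡ ι (kβ , i) → parity (toℕ i) ≡ player₁ → π (suc t) ≡ ι (kγ , i)
        after-β₁ t {i} e pi =
          after-counterCore t (kβ , i) e λ pi≡0 → player₀≢player₁ (trans (sym pi≡0) pi)

        after-γ₀ : ∀ t {i} → π t ≡ ι (kγ , i) → parity (toℕ i) ≡ player₀ →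
                   Σ Index λ j → π (suc t) ≡ ι (kα , j)
        after-γ₀ t {i} e pi with nextα-spec i (≤-trans (s≤s i≤m) (≤-trans (n≤1+n _) m+2≤2k))
          where
            i≤m : toℕ i ≤ m
            i≤m = ≤suc∧parity≡⇒≤ (region-index t (kγ , i) e) (trans pi (sym pm))
        ... | j , _ , e′ = j , trans (after-counterCore t (kγ , i) e ¬ow) e′
          where
            ¬ow : coreOwnerᵖ (kγ , i) ≢ player₀
            ¬ow ow = parity-suc≢ (toℕ i) (trans ow (sym pi))

        after-P : ∀ t → InP (π t) → π (suc t) ≡ prev t
        after-P t π∈P with region t
        ... | inCore c e _ = ⊥-elim (π∈P c e)
        ... | outside i _ pi _ _ mv _ = trans (after-counter t ¬ow) (counter-InP (prev t) π∈P)
          where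
            ¬ow : owner (π t) ≢ player₀
            ¬ow ow = player₀≢player₁ (trans (sym ow) (trans (P-owner π∈P mv) pi))

        Trapped : Index → ℕ → Set
        Trapped j t = π t ≡ ι (kβ , j) ⊎ π t ≡ ι (kγ , j) ⊎ (InP (π t) × prev t ≡ ι (kγ , j))

        trapped-step : ∀ {j} t → parity (toℕ j) ≡ player₁ → pr (π (suc t)) ≤ suc (2 * k + toℕ j) →
                       Trapped j t → Trapped j (suc t)
        trapped-step t pj _ (inj₁ e)                = inj₂ (inj₁ (after-β₁ t e pj))
        trapped-step t pj _ (inj₂ (inj₂ (π∈P , e))) = inj₂ (inj₁ (trans (after-P t π∈P) e))
        trapped-step {j} t pj bound (inj₂ (inj₁ e)) with successor-of-core (kγ , j) (π (suc t)) (move-from t e)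
        ... | inj₁ (_ , e′ , γγ _)           = inj₂ (inj₁ (sym e′))
        ... | inj₁ (_ , e′ , γβ _)           = inj₁ (sym e′)
        ... | inj₁ (_ , e′ , γα _ j′ j′≡1+j) =
              ⊥-elim (<⇒≱ (s≤s (+-monoʳ-< (2 * k) (≤-reflexive (sym j′≡1+j))))
                          (subst (_≤ suc (2 * k + toℕ j)) (trans (cong pr (sym e′)) (pr-α j′)) bound))
        ... | inj₂ (π∈P , _)                 = inj₂ (inj₂ (π∈P , trans (prev-suc t) e))

        Trapped-pr≤ : ∀ {j} t → Trapped j t → pr (π t) ≤ toℕ j
        Trapped-pr≤ {j} t (inj₁ e)                = ≤-reflexive (trans (cong pr e) (ι-pr (kβ , j)))
        Trapped-pr≤ {j} t (inj₂ (inj₁ e))         = ≤-reflexive (trans (cong pr e) (ι-pr (kγ , j)))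
        Trapped-pr≤ {j} t (inj₂ (inj₂ (π∈P , e))) with region t
        ... | inCore c e′ _               = ⊥-elim (π∈P c e′)
        ... | outside _ _ _ _ e′ mv _    = P-pr≤ π∈P (subst (λ x → Move x (π t)) (trans e′ e) mv)


        Trapped-γ : ∀ {j} t → parity (toℕ j) ≡ player₁ → Trapped j t →
                    Σ ℕ λ t′ → t ≤ t′ × π t′ ≡ ι (kγ , j)
        Trapped-γ t pj (inj₁ e)                = suc t , n≤1+n t , after-β₁ t e pj
        Trapped-γ t pj (inj₂ (inj₁ e))         = t , ≤-refl , e
        Trapped-γ t pj (inj₂ (inj₂ (π∈P , e))) = suc t , n≤1+n t , trans (after-P t π∈P) e

        module Limsup (p : ℕ) (p-even : parity p ≡ player₀)
                      (often : ∀ N → Σ ℕ λ t → N ≤ t × pr (π t) ≡ p)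
                      (N : ℕ) (bounded : ∀ t → N ≤ t → pr (π t) ≤ p) where

          Entry : Set
          Entry = Σ Index λ j → parity (toℕ j) ≡ player₁ × p ≤ suc (2 * k + toℕ j) ×
                                 Σ ℕ λ t → N ≤ t × Trapped j t

          p≤top : ∀ (j : Index) → p ≤ 2 * k → p ≤ suc (2 * k + toℕ j)
          p≤top j p≤2k = ≤-trans p≤2k (≤-trans (m≤m+n (2 * k) (toℕ j)) (n≤1+n _))

          index≤2k : ∀ {i : Index} → p ≡ toℕ i → p ≤ 2 * k
          index≤2k {i} p≡i = subst (_≤ 2 * k) (sym p≡i) (toℕ≤2k i)

          no-late-α : p ≤ 2 * k → ∀ t {j} → N ≤ t → π t ≢ ι (kα , j)
          no-late-α p≤2k t {j} N≤t e =
            <⇒≱ (α>2k j) (≤-trans (subst (_≤ p) (cong pr e) (bounded t N≤t)) p≤2k)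

          entry-α : ∀ t i → N ≤ t → p ≡ suc (2 * k + toℕ i) → π t ≡ ι (kα , i) → Entry
          entry-α t i N≤t p≡ e = i , pi , ≤-reflexive p≡ , suc t , m≤n⇒m≤1+n N≤t , inj₁ (after-α t e)
            where
              pi : parity (toℕ i) ≡ player₁
              pi = trans (sym (parity-2*+ k (toℕ i)))
                         (parity-pred (2 * k + toℕ i) (trans (cong parity (sym p≡)) p-even))

          entry-β : ∀ t i → N ≤ t → p ≡ toℕ i → π t ≡ ι (kβ , i) → Entry
          entry-β t i N≤t p≡i e with parity (toℕ i) in pi
          ... | player₁ = i , pi , p≤top i (index≤2k p≡i) , t , N≤t , inj₁ e
          ... | player₀ with successor-of-core (kβ , i) (π (suc t)) (move-from t e)
          ...   | inj₁ (_ , e′ , βα _ j _) =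
                  ⊥-elim (no-late-α (index≤2k p≡i) (suc t) (m≤n⇒m≤1+n N≤t) (sym e′))
          ...   | inj₁ (_ , e′ , βγ _) with after-γ₀ (suc t) (sym e′) pi
          ...     | j , e″ =
                  ⊥-elim (no-late-α (index≤2k p≡i) (suc (suc t)) (m≤n⇒m≤1+n (m≤n⇒m≤1+n N≤t)) e″)

          entry-γ : ∀ t i → N ≤ t → p ≡ toℕ i → π t ≡ ι (kγ , i) → Entry
          entry-γ t i N≤t p≡i e with parity (toℕ i) in pi
          ... | player₁ = i , pi , p≤top i (index≤2k p≡i) , t , N≤t , inj₂ (inj₁ e)
          ... | player₀ with after-γ₀ t e pi
          ...   | j , e′ = ⊥-elim (no-late-α (index≤2k p≡i) (suc t) (m≤n⇒m≤1+n N≤t) e′)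

          entry-P : ∀ t → N ≤ t → pr (π t) ≡ p → InP (π t) → Entry
          entry-P t N≤t prt π∈P with region t
          ... | inCore c e _           = ⊥-elim (π∈P c e)
          ... | outside i _ pi _ e _ _ =
                i , pi , p≤top i (subst (_≤ 2 * k) prt (pr-InP≤2k π∈P)) ,
                t , N≤t , inj₂ (inj₂ (π∈P , sym e))

          p≡pr : ∀ t {v} → pr (π t) ≡ p → v ≡ π t → p ≡ pr v
          p≡pr t prt e = trans (sym prt) (cong pr (sym e))

          entry : Entry
          entry with often N
          ... | t , N≤t , prt with core⊎InP (π t)
          ...   | inj₁ ((kα , i) , e) = entry-α t i N≤t (trans (p≡pr t prt e) (pr-α i)) (sym e)
          ...   | inj₁ ((kβ , i) , e) = entry-β t i N≤t (trans (p≡pr t prt e) (ι-pr (kβ , i))) (sym e)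
          ...   | inj₁ ((kγ , i) , e) = entry-γ t i N≤t (trans (p≡pr t prt e) (ι-pr (kγ , i))) (sym e)
          ...   | inj₂ π∈P            = entry-P t N≤t prt π∈P

          -- Once trapped at an odd j, the play can never leave, so j is the limsup: but p is even.
          absurd : ⊥
          absurd with entry
          ... | j , pj , p≤top-j , t₁ , N≤t₁ , trapped₁ =
            player₀≢player₁ (trans (sym p-even) (trans (cong parity p≡j) pj))
            where
              trappedFrom : ∀ d → Trapped j (d + t₁)
              trappedFrom zero    = trapped₁
              trappedFrom (suc d) = trapped-step (d + t₁) pj
                (≤-trans (bounded (suc (d + t₁)) (≤-trans N≤t₁ (m≤n⇒m≤1+n (m≤n+m t₁ d)))) p≤top-j)
                (trappedFrom d)

              p≤j : p ≤ toℕ j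
              p≤j with often t₁
              ... | t , t₁≤t , prt = subst (_≤ toℕ j) prt
                      (Trapped-pr≤ t (subst (Trapped j) (m∸n+n≡m t₁≤t) (trappedFrom (t ∸ t₁))))

              j≤p : toℕ j ≤ p
              j≤p with Trapped-γ t₁ pj trapped₁
              ... | t , t₁≤t , e =
                subst (_≤ p) (trans (cong pr e) (ι-pr (kγ , j))) (bounded t (≤-trans N≤t₁ t₁≤t))

              p≡j : p ≡ toℕ j
              p≡j = ≤-antisym p≤j j≤p

        notWin : ¬ Wins0 π
        notWin (p , p-even , often , N , bounded) =
          Limsup.absurd p (trans (sym (mod2≡parity p)) p-even) often N bounded

    Region⇒¬W0 : ∀ prev {v} → Region prev v → ¬ W0 S v
    Region⇒¬W0 prev {v} r (_ , σ , legal , wins) = notWin (wins π consistent)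
      where open Against.Play σ legal prev v r

  -- The subgame tree

  Shape : Sub → ℕ → Set
  Shape S m = ContainsCore S m × NoAlphaAbove S m

  Shape′ : Sub → ℕ → Set
  Shape′ S m = (∀ c → LowerCore m c → S (ι c)) × NoAlphaAbove S (suc m)

  NoAlphaAbove-∖Attr : ∀ ℘ S M → NoAlphaAbove S (suc M) → NoAlphaAbove (S ∖ Attr ℘ S (Alpha (suc M))) M
  NoAlphaAbove-∖Attr ℘ S M noα j M<j (sα , ¬attr) with m≤n⇒m<n∨m≡n M<j
  ... | inj₁ 1+M<j = noα j 1+M<j sα
  ... | inj₂ 1+M≡j = ¬attr (base sα (j , sym 1+M≡j , refl))

  module NextLevel (S : Sub) (m : ℕ) (pm : parity m ≡ player₀) (m+2≤2k : suc (suc m) ≤ 2 * k)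
                   (core : ContainsCore S (suc (suc m))) (noα : NoAlphaAbove S (suc (suc m))) where

    Z : ℕ
    Z = suc (suc m)

    pZ : parity Z ≡ player₀
    pZ = trans (opponent-involutive (parity m)) pm

    S′ S″ : Sub
    S′ = S ∖ Attr player₁ S (Alpha Z)
    S″ = S ∖ Attr player₀ S (W0 S′)

    S′-core : ∀ c → index c ≤ Z → ¬ IsAlpha Z c → S′ (ι c)
    S′-core c c≤Z ¬α = core c c≤Z , Attr₁-α-avoids-core S Z pZ core noα c c≤Z ¬α

    S′-lowerCore : ContainsCore S′ (suc m)
    S′-lowerCore c c≤1+m = S′-core c (m≤n⇒m≤1+n c≤1+m)
      λ α → 1+n≰n (subst (_≤ suc m) (IsAlpha⇒index≡ c α) c≤1+m)

    S′-shape : Shape′ S′ m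
    S′-shape = (λ c lc → S′-lowerCore c (LowerCore⇒≤ c lc)) ,
               NoAlphaAbove-∖Attr player₁ S (suc m) noα

    open Counterplay S′ m pm m+2≤2k S′-lowerCore (proj₂ S′-shape)

    -- Membership in S′ is only classically decidable, which suffices for a negated goal.
    αZ-attracted : ∀ j → toℕ j ≡ Z → ¬ ¬ Attr player₀ S (W0 S′) (ι (kα , j))
    αZ-attracted j j≡Z ¬attr = ¬¬-decidable S′ λ S′? →
      ¬attr (own (ι (kβ , j)) (s kα) (trans (owner-ι (kα , j)) pj) (CoreE⇒move (αβ j)) (s kβ)
              (own (ι (kγ , j)) (s kβ) (trans (owner-ι (kβ , j)) pj) (CoreE⇒move (βγ j)) (s kγ)
                (base (s kγ) (γ-even∈W0 S′ S′? j pj (S′-core (kγ , j) (≤-reflexive j≡Z) λ ()) noα-S′))))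
      where
        pj : parity (toℕ j) ≡ player₀
        pj = trans (cong parity j≡Z) pZ

        s : ∀ κ → S (ι (κ , j))
        s κ = core (κ , j) (≤-reflexive j≡Z)

        noα-S′ : NoAlphaAbove S′ (toℕ j)
        noα-S′ i j<i s′ = noα i (subst (_< toℕ i) j≡Z j<i) (proj₁ s′)

    ¬W0-core : ∀ c → LowerCore m c → ¬ W0 S′ (ι c)
    ¬W0-core c lc = Region⇒¬W0 (ι c) (inCore c refl (LowerCore⇒≤ c lc))

    ¬W0-P : ∀ v i → InP v → owner v ≢ player₀ → toℕ i ≤ m → Move (ι (kγ , i)) v → ¬ W0 S′ v
    ¬W0-P v i v∈P ¬ow i≤m mv w0 = Region⇒¬W0 (ι (kγ , i)) region w0
      where
        region : Region (ι (kγ , i)) v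
        region = outside i v∈P (trans (sym (P-owner v∈P mv)) (≢⇒≡opponent ¬ow)) (m≤n⇒m≤1+n i≤m)
                         refl mv (proj₁ w0)

    S″-shape : Shape′ S″ m
    S″-shape = (λ c lc → core c (m≤n⇒m≤1+n (LowerCore⇒≤ c lc)) , ¬attr c lc) , noα-S″
      where
        ¬attr : ∀ c → LowerCore m c → ¬ Attr player₀ S (W0 S′) (ι c)
        ¬attr = Attr₀-avoids-LowerCore S (W0 S′) m pm (λ c c≤1+m → core c (m≤n⇒m≤1+n c≤1+m)) ¬W0-core ¬W0-P

        noα-S″ : NoAlphaAbove S″ (suc m)
        noα-S″ j 1+m<j (sα , ¬attr) with m≤n⇒m<n∨m≡n 1+m<j
        ... | inj₁ Z<j = noα j Z<j sα
        ... | inj₂ Z≡j = αZ-attracted j (sym Z≡j) ¬attr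

  z-even : ∀ w → parity (z w) ≡ player₀
  z-even w = parity-2* (k ∸ len w)

  z≤2k : ∀ w → z w ≤ 2 * k
  z≤2k w = *-monoʳ-≤ 2 (m∸n≤m k (len w))

  z-step : ∀ u d → suc (len u) ≤ k → z u ≡ suc (suc (z (u ▷ d)))
  z-step u d 1+|u|≤k = trans (cong (2 *_) (+-∸-assoc 1 1+|u|≤k)) (*-suc 2 (k ∸ suc (len u)))

  nextLevel : ∀ S Z m → Z ≡ suc (suc m) → parity m ≡ player₀ → suc (suc m) ≤ 2 * k → Shape S Z →
              let S′ = S ∖ Attr player₁ S (Alpha Z) in
              Shape′ S′ m × Shape′ (S ∖ Attr player₀ S (W0 S′)) m
  nextLevel S _ m refl pm m+2≤2k (core , noα) = S′-shape , S″-shape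
    where open NextLevel S m pm m+2≤2k core noα

  mutual
    Gs-shape : ∀ w → len w ≤ k → Shape (Gs w) (z w)
    Gs-shape ε _ = (λ _ _ → tt) , λ j 2k<j _ → <⇒≱ 2k<j (toℕ≤2k j)
    Gs-shape (u ▷ d) |w|≤k = core , NoAlphaAbove-∖Attr player₀ (G's (u ▷ d)) m (proj₂ shape′)
      where
        m = z (u ▷ d)
        shape′ = G's-shape u d |w|≤k
        core′ : ContainsCore (G's (u ▷ d)) m
        core′ c c≤m = proj₁ shape′ c (≤⇒LowerCore c c≤m)
        core : ContainsCore (Gs (u ▷ d)) m
        core c c≤m = core′ c c≤m , Attr₀-α-avoids-core (G's (u ▷ d)) m (z-even (u ▷ d)) core′ c c≤m

    G's-shape : ∀ u d → suc (len u) ≤ k → Shape′ (G's (u ▷ d)) (z (u ▷ d))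
    G's-shape u L 1+|u|≤k = proj₁ (G's-shapes u 1+|u|≤k)
    G's-shape u R 1+|u|≤k = proj₂ (G's-shapes u 1+|u|≤k)

    G's-shapes : ∀ u → suc (len u) ≤ k →
                 Shape′ (G's (u ▷ L)) (z (u ▷ L)) × Shape′ (G's (u ▷ R)) (z (u ▷ L))
    G's-shapes u 1+|u|≤k = nextLevel (Gs u) (z u) (z (u ▷ L)) (z-step u L 1+|u|≤k) (z-even (u ▷ L))
      (subst (_≤ 2 * k) (z-step u L 1+|u|≤k) (z≤2k u)) (Gs-shape u (≤-trans (n≤1+n _) 1+|u|≤k))

  FL-Gs : ∀ w → len w ≤ k → FL (Gs w) (G's (w ▷ L)) player₁
  FL-Gs w |w|≤k = FL-topAlpha (Gs w) player₁ (z w) g g≡z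
    (proj₁ shape (kα , g) (≤-reflexive g≡z)) (proj₂ shape) (cong opponent (sym (z-even w)))
    where
      shape = Gs-shape w |w|≤k
      g = toIndex (z w) (z≤2k w)
      g≡z = toℕ-toIndex (z w) (z≤2k w)

  FL-G's : ∀ u d → suc (len u) ≤ k → FL (G's (u ▷ d)) (Gs (u ▷ d)) player₀
  FL-G's u d 1+|u|≤k = FL-topAlpha (G's (u ▷ d)) player₀ (suc m) g g≡1+m
    (proj₁ shape′ (kα , g) (≤-reflexive g≡1+m)) (proj₂ shape′)
    (sym (trans (opponent-involutive (parity m)) (z-even (u ▷ d))))
    where
      m = z (u ▷ d)
      shape′ = G's-shape u d 1+|u|≤k
      1+m≤2k : suc m ≤ 2 * k
      1+m≤2k = ≤-trans (n≤1+n _) (subst (_≤ 2 * k) (z-step u d 1+|u|≤k) (z≤2k u))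
      g = toIndex (suc m) 1+m≤2k
      g≡1+m = toℕ-toIndex (suc m) 1+m≤2k

lemma2 : (fam : (k : ℕ) → 1 ≤ k → CoreExt k) →
         (k : ℕ) (hk : 1 ≤ k) (w : Word) → len w ≤ k →
         let open Tree (fam k hk) in
         FL (Gs w) (G's (w ▷ L)) (Fin.suc Fin.zero) ×
         (fR (Gs w) (W0 (G's (w ▷ L))) Fin.zero ≐ G's (w ▷ R)) ×
         (w ≢ ε → FL (G's w) (Gs w) Fin.zero)
lemma2 fam k hk w |w|≤k = FL-Gs w |w|≤k , (λ _ → id , id) , FL-G's′ w |w|≤k
  where
    open Tree (fam k hk)
    open CoreExtension (fam k hk)

    FL-G's′ : ∀ w → len w ≤ k → w ≢ ε → FL (G's w) (Gs w) player₀
    FL-G's′ ε       _     ε≢ε = ⊥-elim (ε≢ε refl)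
    FL-G's′ (u ▷ d) |w|≤k _   = FL-G's u d |w|≤k
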